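{- Let $\mathcal{U}\neq\{\Omega_n,\emptyset\}$ be a family of subsets of $\Omega_n=\{1,\dots,n\}$ closed under pairwise union and containing $\Omega_n$ and $\emptyset$, and suppose $\mathcal{U}$ is canonical (as defined in the context). Write $\mathcal{U}=\{A_1,A_2,\dots,A_k,\emptyset\}$ with $A_1<A_2<\dots<A_k$ the non-empty members, and let $1\le m\le k$. Then $\{A_1,A_2,\dots,A_m,\emptyset\}$ is also canonical.
   Context: For $A\subseteq\Omega_n$ let $b(A)=\sum_{i\in A}2^{i-1}$. Subsets of $\Omega_n$ are totally ordered by: $A>B$ if $|A|<|B|$, or $|A|=|B|$ and $b(A)>b(B)$ (so $\emptyset$ is the largest set and sets with more elements are smaller). For a family $\mathcal{U}$ of subsets of $\Omega_n$ containing $\emptyset$ whose non-empty members are $A_1<\dots<A_k$, define the string $s(\mathcal{U})=(b(A_1),\dots,b(A_k))$. For a permutation $\Pi$ of $\Omega_n$, $\Pi(\mathcal{U})=\{\Pi(A):A\in\mathcal{U}\}$. The family $\mathcal{U}$ is called canonical (the canonical representative of its isomorphism class) if $s(\mathcal{U})$ is lexicographically smallest among all strings $s(\Pi(\mathcal{U}))$, $\Pi$ ranging over all permutations of $\Omega_n$. -}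

module Defs where

open import Data.Nat using (ℕ; zero; suc; _+_; _*_; _^_; _<_; _≤_)
open import Data.Bool using (Bool; true; false; if_then_else_)
open import Data.Fin using (Fin; toℕ)
open import Data.Fin.Subset using (Subset; ⊥; ⊤; _∪_; ∣_∣)
open import Data.Vec using (lookup; tabulate)
open import Data.List using (List; []; _∷_; map; allFin)
open import Data.Nat.ListAction using (sum)
open import Data.List.Membership.Propositional using (_∈_)
open import Data.List.Relation.Unary.Linked using (Linked)
open import Data.Fin.Permutation using (Permutation′; _⟨$⟩ˡ_)
open import Data.Product using (Σ; _×_)
open import Data.Sum using (_⊎_)
open import Relation.Binary.PropositionalEquality using (_≡_; _≢_)

-- Subsets of Ω_n = {1,…,n} are Subset n; index i : Fin n stands for element toℕ i + 1.

-- b(A) = Σ_{i ∈ A} 2^(i-1)  (0-based index i has weight 2^i)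
b : ∀ {n} → Subset n → ℕ
b {n} A = sum (map (λ i → if lookup A i then 2 ^ toℕ i else 0) (allFin n))

_≺_ : ∀ {n} → Subset n → Subset n → Set
A ≺ B = (∣ B ∣ < ∣ A ∣) ⊎ ((∣ B ∣ ≡ ∣ A ∣) × (b A < b B))

Increasing : ∀ {n} → List (Subset n) → Set
Increasing = Linked _≺_

Mem : ∀ {n} → List (Subset n) → Subset n → Set
Mem As X = (X ≡ ⊥) ⊎ (X ∈ As)

NonEmptyMembers : ∀ {n} → List (Subset n) → Set
NonEmptyMembers As = Increasing As × (∀ X → X ∈ As → X ≢ ⊥)

-- Π(A) = { Π(i) : i ∈ A }, i.e. j ∈ Π(A) iff Π⁻¹(j) ∈ A
applyPerm : ∀ {n} → Permutation′ n → Subset n → Subset n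
applyPerm π A = tabulate (λ j → lookup A (π ⟨$⟩ˡ j))

data LexLeq : List ℕ → List ℕ → Set where
  nil   : ∀ {ys} → LexLeq [] ys
  here  : ∀ {x y xs ys} → x < y → LexLeq (x ∷ xs) (y ∷ ys)
  there : ∀ {x xs ys} → LexLeq xs ys → LexLeq (x ∷ xs) (x ∷ ys)

string : ∀ {n} → List (Subset n) → List ℕ
string As = map b As

IsImageMembers : ∀ {n} → Permutation′ n → List (Subset n) → List (Subset n) → Set
IsImageMembers {n} π As Bs =
  Increasing Bs ×
  (∀ (X : Subset n) →
     (X ∈ Bs → (X ≢ ⊥) × Σ (Subset n) (λ Y → Mem As Y × (X ≡ applyPerm π Y))) ×
     ((X ≢ ⊥) × Σ (Subset n) (λ Y → Mem As Y × (X ≡ applyPerm π Y)) → X ∈ Bs))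

Canonical : ∀ {n} → List (Subset n) → Set
Canonical {n} As =
  ∀ (π : Permutation′ n) (Bs : List (Subset n)) →
    IsImageMembers π As Bs → LexLeq (string As) (string Bs)

UnionClosed : ∀ {n} → List (Subset n) → Set
UnionClosed As = ∀ X Y → Mem As X → Mem As Y → Mem As (X ∪ Y)

IsTrivial : ∀ {n} → List (Subset n) → Set
IsTrivial {n} As = ∀ (X : Subset n) → (Mem As X → (X ≡ ⊤) ⊎ (X ≡ ⊥)) × ((X ≡ ⊤) ⊎ (X ≡ ⊥) → Mem As X)

-- Permutations preserve cardinality.  Let C₁ < … < C_k be the sorted image of U under Π and
-- B₁ < … < B_m that of U_m = {A₁,…,A_m,∅}.  Canonicity of U gives s(A₁…A_m) ≤ s(C₁…C_m).
-- Every B is a C, and a C that is not a B is the image of some A_j with j > m, hence no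
-- larger than any B.  So at the first index where C₁…C_m and B₁…B_m differ we have C_i < B_i
-- with |C_i| = |B_i|, i.e. b(C_i) < b(B_i), and s(C₁…C_m) ≤ s(B₁…B_m).
module Submission where

open import Defs
open import Data.Nat using (ℕ; zero; suc; _+_; _*_; _^_; _<_; _≤_; _⊓_; z≤n; s≤s)
open import Data.Nat.Properties
open import Data.Nat.ListAction using (sum)
open import Data.Bool using (Bool; true; false; if_then_else_)
open import Data.Bool.Properties using (if-float)
open import Data.Fin as Fin using (Fin; toℕ)
open import Data.Fin.Subset using (Subset; ⊥; ⊤; ∣_∣; outside)
open import Data.Fin.Permutation using (Permutation′; _⟨$⟩ˡ_; _⟨$⟩ʳ_; flip; inverseˡ)
open import Data.Vec using ([]; _∷_; lookup)
open import Data.Vec.Properties using (lookup∘tabulate; tabulate∘lookup; tabulate-cong; lookup-replicate)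
open import Data.List as List using (List; []; _∷_; map; _++_; take; drop; length)
open import Data.List.Properties
  using (map-tabulate; length-++-sucʳ; take++drop≡id; take-map; length-take; length-map)
  renaming (tabulate-cong to List-tabulate-cong)
open import Data.List.Membership.Propositional using (_∈_; _∉_)
open import Data.List.Membership.Propositional.Properties
  using (∈-map⁻; ∈-map⁺; ∈-∃++; ∈-++⁺ˡ; ∈-++⁺ʳ; ∈-++⁻)
open import Data.List.Relation.Unary.Any using (here; there)
import Data.List.Relation.Unary.All as All
open import Data.List.Relation.Unary.AllPairs as AllPairs using (AllPairs; []; _∷_)
open import Data.List.Relation.Unary.Linked as Linked using (Linked)
open import Data.List.Relation.Unary.Linked.Properties using (Linked⇒AllPairs; AllPairs⇒Linked)
open import Data.List.Relation.Unary.Unique.Propositional using (Unique)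
open import Data.List.Relation.Unary.Unique.Propositional.Properties as UniqueProperties
  using (Unique[x∷xs]⇒x∉xs)
open import Data.List.Relation.Binary.Subset.Propositional using (_⊆_)
open import Data.List.Relation.Binary.Permutation.Propositional using (↭-sym; ↭⇒↭ₛ)
open import Data.List.Relation.Binary.Permutation.Propositional.Properties using (∈-resp-↭; shift)
import Data.List.Relation.Binary.Permutation.Setoid.Properties as PermutationSetoid
import Data.List.Sort as Sort
open import Data.Product using (_×_; _,_; ∃-syntax; proj₁; proj₂)
open import Data.Sum using (_⊎_; inj₁; inj₂)
open import Function using (_∘_; id)
open import Relation.Nullary using (¬_; contradiction)
open import Relation.Binary.Definitions using (Trichotomous; Tri; tri<; tri≈; tri>)
open import Relation.Binary.Bundles using (StrictTotalOrder)
import Relation.Binary.Properties.StrictTotalOrder as StrictTotalOrderProperties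
open import Relation.Binary.PropositionalEquality
open import Relation.Binary.PropositionalEquality.Properties using (isEquivalence)
import Algebra.Properties.CommutativeMonoid.Sum as CommutativeMonoidSum

module _ {A : Set} where

  Unique-⊆⇒length-≤ : {xs ys : List A} → Unique xs → xs ⊆ ys → length xs ≤ length ys
  Unique-⊆⇒length-≤ [] _ = z≤n
  Unique-⊆⇒length-≤ {x ∷ xs} (x∉xs ∷ unique) x∷xs⊆ys
    with ys₁ , ys₂ , refl ← ∈-∃++ (x∷xs⊆ys (here refl)) = begin
      suc (length xs)           ≤⟨ s≤s (Unique-⊆⇒length-≤ unique xs⊆ys₁++ys₂) ⟩
      suc (length (ys₁ ++ ys₂)) ≡⟨ length-++-sucʳ ys₁ x ys₂ ⟨
      length (ys₁ ++ x ∷ ys₂)   ∎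
    where
    open ≤-Reasoning
    xs⊆ys₁++ys₂ : xs ⊆ ys₁ ++ ys₂
    xs⊆ys₁++ys₂ z∈xs with ∈-resp-↭ (shift x ys₁ ys₂) (x∷xs⊆ys (there z∈xs))
    ... | here refl = contradiction refl (All.lookup x∉xs z∈xs)
    ... | there z∈  = z∈

  ∈-take⇒∈ : ∀ m {x} {xs : List A} → x ∈ take m xs → x ∈ xs
  ∈-take⇒∈ m {xs = xs} x∈ = subst (_ ∈_) (take++drop≡id m xs) (∈-++⁺ˡ x∈)

  ∈-drop⇒∈ : ∀ m {x} {xs : List A} → x ∈ drop m xs → x ∈ xs
  ∈-drop⇒∈ m {xs = xs} x∈ = subst (_ ∈_) (take++drop≡id m xs) (∈-++⁺ʳ (take m xs) x∈)

  ∈⇒∈-take⊎∈-drop : ∀ m {x} {xs : List A} → x ∈ xs → x ∈ take m xs ⊎ x ∈ drop m xs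
  ∈⇒∈-take⊎∈-drop m {xs = xs} x∈ = ∈-++⁻ (take m xs) (subst (_ ∈_) (sym (take++drop≡id m xs)) x∈)

  AllPairs-take-drop : ∀ {R : A → A → Set} m {x y} {xs : List A} → AllPairs R xs →
    x ∈ take m xs → y ∈ drop m xs → R x y
  AllPairs-take-drop (suc m) {xs = _ ∷ xs} (Rx ∷ _) (here refl) y∈ = All.lookup Rx (∈-drop⇒∈ m y∈)
  AllPairs-take-drop (suc m) {xs = _ ∷ xs} (_ ∷ R) (there x∈) y∈ = AllPairs-take-drop m R x∈ y∈

  ⊆-∷⁻ : ∀ {x} {xs ys : List A} → x ∉ xs → x ∷ xs ⊆ x ∷ ys → xs ⊆ ys
  ⊆-∷⁻ x∉xs sub z∈xs with sub (there z∈xs)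
  ... | here refl = contradiction z∈xs x∉xs
  ... | there z∈ys = z∈ys

LexLeq-trans : ∀ {xs ys zs} → LexLeq xs ys → LexLeq ys zs → LexLeq xs zs
LexLeq-trans nil       _         = nil
LexLeq-trans (here p)  (here q)  = here (<-trans p q)
LexLeq-trans (here p)  (there _) = here p
LexLeq-trans (there _) (here q)  = here q
LexLeq-trans (there p) (there q) = there (LexLeq-trans p q)

LexLeq-take : ∀ m {xs ys} → LexLeq xs ys → LexLeq (take m xs) (take m ys)
LexLeq-take zero    _         = nil
LexLeq-take (suc m) nil       = nil
LexLeq-take (suc m) (here p)  = here p
LexLeq-take (suc m) (there p) = there (LexLeq-take m p)

module FinSum = CommutativeMonoidSum +-0-commutativeMonoid

bit : Bool → ℕ
bit x = if x then 1 else 0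

sum-tabulate-* : ∀ {n} k (f : Fin n → ℕ) →
  sum (List.tabulate (λ i → k * f i)) ≡ k * sum (List.tabulate f)
sum-tabulate-* {zero}  k f = sym (*-zeroʳ k)
sum-tabulate-* {suc n} k f = begin
  k * f Fin.zero + sum (List.tabulate (λ i → k * f (Fin.suc i)))
    ≡⟨ cong (k * f Fin.zero +_) (sum-tabulate-* k (f ∘ Fin.suc)) ⟩
  k * f Fin.zero + k * sum (List.tabulate (f ∘ Fin.suc))
    ≡⟨ *-distribˡ-+ k (f Fin.zero) _ ⟨
  k * sum (List.tabulate f) ∎
  where open ≡-Reasoning

b-∷ : ∀ {n} x (A : Subset n) → b (x ∷ A) ≡ bit x + 2 * b A
b-∷ x A = cong (bit x +_) (begin
  sum (map (weight (x ∷ A)) (List.tabulate Fin.suc))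
    ≡⟨ cong sum (map-tabulate Fin.suc (weight (x ∷ A))) ⟩
  sum (List.tabulate (weight (x ∷ A) ∘ Fin.suc))
    ≡⟨ cong sum (List-tabulate-cong (λ i → sym (if-float (2 *_) (lookup A i)))) ⟩
  sum (List.tabulate (λ i → 2 * weight A i))
    ≡⟨ sum-tabulate-* 2 (weight A) ⟩
  2 * sum (List.tabulate (weight A))
    ≡⟨ cong (λ l → 2 * sum l) (map-tabulate id (weight A)) ⟨
  2 * b A ∎)
  where
  open ≡-Reasoning
  weight : ∀ {k} → Subset k → Fin k → ℕ
  weight X i = if lookup X i then 2 ^ toℕ i else 0

bit+2*-injective : ∀ x y {a c} → bit x + 2 * a ≡ bit y + 2 * c → x ≡ y × a ≡ c
bit+2*-injective true  true  {a} {c} eq = refl , *-cancelˡ-≡ a c 2 (suc-injective eq)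
bit+2*-injective false false {a} {c} eq = refl , *-cancelˡ-≡ a c 2 eq
bit+2*-injective true  false {a} {c} eq = contradiction (sym eq) (even≢odd c a)
bit+2*-injective false true  {a} {c} eq = contradiction eq (even≢odd a c)

b-injective : ∀ {n} {A B : Subset n} → b A ≡ b B → A ≡ B
b-injective {A = []}    {[]}    _  = refl
b-injective {A = x ∷ A} {y ∷ B} eq
  with bit+2*-injective x y (trans (sym (b-∷ x A)) (trans eq (b-∷ y B)))
... | refl , bA≡bB = cong (x ∷_) (b-injective bA≡bB)

module _ {n : ℕ} (π : Permutation′ n) where

  lookup-applyPerm : ∀ X j → lookup (applyPerm π X) j ≡ lookup X (π ⟨$⟩ˡ j)
  lookup-applyPerm X = lookup∘tabulate (lookup X ∘ (π ⟨$⟩ˡ_))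

  applyPerm-flip : ∀ X → applyPerm (flip π) (applyPerm π X) ≡ X
  applyPerm-flip X = trans
    (tabulate-cong (λ i → trans (lookup-applyPerm X (π ⟨$⟩ʳ i)) (cong (lookup X) (inverseˡ π))))
    (tabulate∘lookup X)

  applyPerm-injective : ∀ {X Y} → applyPerm π X ≡ applyPerm π Y → X ≡ Y
  applyPerm-injective {X} {Y} eq =
    trans (sym (applyPerm-flip X)) (trans (cong (applyPerm (flip π)) eq) (applyPerm-flip Y))

  applyPerm-⊥ : applyPerm π ⊥ ≡ ⊥
  applyPerm-⊥ = trans
    (tabulate-cong (λ j → trans (lookup-replicate (π ⟨$⟩ˡ j) outside) (sym (lookup-replicate j outside))))
    (tabulate∘lookup ⊥)

  applyPerm-≢⊥ : ∀ {X} → X ≢ ⊥ → applyPerm π X ≢ ⊥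
  applyPerm-≢⊥ X≢⊥ eq = X≢⊥ (applyPerm-injective (trans eq (sym applyPerm-⊥)))

∣X∣≡sum-bit : ∀ {n} (X : Subset n) → ∣ X ∣ ≡ FinSum.sum (bit ∘ lookup X)
∣X∣≡sum-bit []          = refl
∣X∣≡sum-bit (true ∷ X)  = cong suc (∣X∣≡sum-bit X)
∣X∣≡sum-bit (false ∷ X) = ∣X∣≡sum-bit X

applyPerm-preserves-∣∣ : ∀ {n} (π : Permutation′ n) X → ∣ applyPerm π X ∣ ≡ ∣ X ∣
applyPerm-preserves-∣∣ {n} π X = begin
  ∣ applyPerm π X ∣
    ≡⟨ ∣X∣≡sum-bit (applyPerm π X) ⟩
  FinSum.sum (bit ∘ lookup (applyPerm π X))
    ≡⟨ FinSum.sum-cong-≗ (cong bit ∘ lookup-applyPerm π X) ⟩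
  FinSum.sum (bit ∘ lookup X ∘ (π ⟨$⟩ˡ_))
    ≡⟨ FinSum.sum-permute _ π ⟩
  FinSum.sum (bit ∘ lookup X ∘ (π ⟨$⟩ˡ_) ∘ (π ⟨$⟩ʳ_))
    ≡⟨ FinSum.sum-cong-≗ {n} (λ _ → cong (bit ∘ lookup X) (inverseˡ π)) ⟩
  FinSum.sum (bit ∘ lookup X)
    ≡⟨ ∣X∣≡sum-bit X ⟨
  ∣ X ∣ ∎
  where open ≡-Reasoning

module _ {n : ℕ} where

  ≺-irrefl : {A : Subset n} → ¬ (A ≺ A)
  ≺-irrefl (inj₁ p)       = <-irrefl refl p
  ≺-irrefl (inj₂ (_ , p)) = <-irrefl refl p

  ≺-trans : {A B C : Subset n} → A ≺ B → B ≺ C → A ≺ C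
  ≺-trans (inj₁ p)       (inj₁ q)        = inj₁ (<-trans q p)
  ≺-trans (inj₁ p)       (inj₂ (e , _))  = inj₁ (subst (_< _) (sym e) p)
  ≺-trans (inj₂ (e , _)) (inj₁ q)        = inj₁ (subst (_ <_) e q)
  ≺-trans (inj₂ (e , p)) (inj₂ (e′ , q)) = inj₂ (trans e′ e , <-trans p q)

  private
    tri-≺ : {A B : Subset n} → A ≺ B → Tri (A ≺ B) (A ≡ B) (B ≺ A)
    tri-≺ {A} {B} p = tri< p (λ { refl → ≺-irrefl {A} p }) (λ q → ≺-irrefl {A} (≺-trans {A} {B} {A} p q))

    tri-≻ : {A B : Subset n} → B ≺ A → Tri (A ≺ B) (A ≡ B) (B ≺ A)
    tri-≻ {A} {B} p = tri> (λ q → ≺-irrefl {B} (≺-trans {B} {A} {B} p q)) (λ { refl → ≺-irrefl {A} p }) p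

  ≺-compare : Trichotomous _≡_ (_≺_ {n})
  ≺-compare A B with <-cmp ∣ B ∣ ∣ A ∣ | <-cmp (b A) (b B)
  ... | tri< p _ _ | _          = tri-≺ {A} {B} (inj₁ p)
  ... | tri> _ _ p | _          = tri-≻ {A} {B} (inj₁ p)
  ... | tri≈ _ e _ | tri< p _ _ = tri-≺ {A} {B} (inj₂ (e , p))
  ... | tri≈ _ e _ | tri> _ _ p = tri-≻ {A} {B} (inj₂ (sym e , p))
  ... | tri≈ _ _ _ | tri≈ _ e _ with refl ← b-injective {A = A} {B} e =
    tri≈ (≺-irrefl {A}) refl (≺-irrefl {A})

  ≺-strictTotalOrder : StrictTotalOrder _ _ _
  ≺-strictTotalOrder = record
    { isStrictTotalOrder = record
      { isStrictPartialOrder = record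
        { isEquivalence = isEquivalence
        ; irrefl        = λ { {A} refl → ≺-irrefl {A} }
        ; trans         = λ {A} {B} {C} → ≺-trans {A} {B} {C}
        ; <-resp-≈      = resp₂ _≺_
        }
      ; compare = ≺-compare
      }
    }

  ≺⇒∣B∣≤∣A∣ : {A B : Subset n} → A ≺ B → ∣ B ∣ ≤ ∣ A ∣
  ≺⇒∣B∣≤∣A∣ (inj₁ p)       = <⇒≤ p
  ≺⇒∣B∣≤∣A∣ (inj₂ (e , _)) = ≤-reflexive e

  ≺∧∣A∣≤∣B∣⇒b< : {A B : Subset n} → A ≺ B → ∣ A ∣ ≤ ∣ B ∣ → b A < b B
  ≺∧∣A∣≤∣B∣⇒b< (inj₁ p)       ∣A∣≤∣B∣ = contradiction ∣A∣≤∣B∣ (<⇒≱ p)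
  ≺∧∣A∣≤∣B∣⇒b< (inj₂ (_ , p)) _       = p

  Increasing⇒AllPairs : {As : List (Subset n)} → Increasing As → AllPairs _≺_ As
  Increasing⇒AllPairs = Linked⇒AllPairs (λ {A} {B} {C} → ≺-trans {A} {B} {C})

  AllPairs⇒Unique : {As : List (Subset n)} → AllPairs _≺_ As → Unique As
  AllPairs⇒Unique = AllPairs.map λ { {A} p refl → ≺-irrefl {A} p }

module _ {n : ℕ} where
  open StrictTotalOrderProperties (≺-strictTotalOrder {n}) using (decTotalOrder)
  open Sort decTotalOrder using (sort; sort-↭; sort-↗)
  open PermutationSetoid (setoid (Subset n)) using (Unique-resp-↭)

  sortedUnique⇒Increasing : {As : List (Subset n)} →
    Linked (λ A B → A ≺ B ⊎ A ≡ B) As → Unique As → Increasing As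
  sortedUnique⇒Increasing sorted unique = Linked.zipWith strict (sorted , AllPairs⇒Linked unique)
    where
    strict : {A B : Subset n} → (A ≺ B ⊎ A ≡ B) × A ≢ B → A ≺ B
    strict (inj₁ A≺B , _)   = A≺B
    strict (inj₂ A≡B , A≢B) = contradiction A≡B A≢B

  module _ (π : Permutation′ n) where

    sortedImage : List (Subset n) → List (Subset n)
    sortedImage As = sort (map (applyPerm π) As)

    ∈-sortedImage⁻ : ∀ {X} As → X ∈ sortedImage As → ∃[ Y ] Y ∈ As × X ≡ applyPerm π Y
    ∈-sortedImage⁻ As X∈ = ∈-map⁻ (applyPerm π) (∈-resp-↭ (sort-↭ (map (applyPerm π) As)) X∈)

    ∈-sortedImage⁺ : ∀ {Y} As → Y ∈ As → applyPerm π Y ∈ sortedImage As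
    ∈-sortedImage⁺ As Y∈ = ∈-resp-↭ (↭-sym (sort-↭ (map (applyPerm π) As))) (∈-map⁺ (applyPerm π) Y∈)

    sortedImage-increasing : ∀ {As} → Increasing As → Increasing (sortedImage As)
    sortedImage-increasing {As} increasing =
      sortedUnique⇒Increasing (sort-↗ (map (applyPerm π) As))
        (Unique-resp-↭ (↭⇒↭ₛ (↭-sym (sort-↭ (map (applyPerm π) As))))
          (UniqueProperties.map⁺ (applyPerm-injective π)
            (AllPairs⇒Unique (Increasing⇒AllPairs increasing))))

    sortedImage-isImage : ∀ {As} → NonEmptyMembers As → IsImageMembers π As (sortedImage As)
    sortedImage-isImage {As} (increasing , nonEmpty) = sortedImage-increasing increasing , λ X →
      (λ X∈ → let Y , Y∈ , X≡πY = ∈-sortedImage⁻ As X∈ in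
         (λ X≡⊥ → applyPerm-≢⊥ π (nonEmpty Y Y∈) (trans (sym X≡πY) X≡⊥)) , Y , inj₂ Y∈ , X≡πY) ,
      λ { (X≢⊥ , _ , inj₁ refl , refl) → contradiction (applyPerm-⊥ π) X≢⊥
        ; (_ , Y , inj₂ Y∈ , refl)     → ∈-sortedImage⁺ As Y∈ }

module _ {n} (π : Permutation′ n) {As Bs : List (Subset n)} (image : IsImageMembers π As Bs) where

  image-∈⁻ : ∀ {X} → X ∈ Bs → ∃[ Y ] Y ∈ As × X ≡ applyPerm π Y
  image-∈⁻ {X} X∈ with proj₁ (proj₂ image X) X∈
  ... | X≢⊥ , _ , inj₁ refl , refl = contradiction (applyPerm-⊥ π) X≢⊥
  ... | _   , Y , inj₂ Y∈   , X≡πY = Y , Y∈ , X≡πY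

  image-∈⁺ : (∀ Y → Y ∈ As → Y ≢ ⊥) → ∀ {Y} → Y ∈ As → applyPerm π Y ∈ Bs
  image-∈⁺ nonEmpty {Y} Y∈ =
    proj₂ (proj₂ image (applyPerm π Y)) (applyPerm-≢⊥ π (nonEmpty Y Y∈) , Y , inj₂ Y∈ , refl)

module _ {n : ℕ} where

  ≺-head⇒∉ : ∀ {A x} {xs : List (Subset n)} → A ≺ x → AllPairs _≺_ (x ∷ xs) → A ∉ x ∷ xs
  ≺-head⇒∉ {A} A≺x _ (here refl) = ≺-irrefl {A = A} A≺x
  ≺-head⇒∉ {A} {x} A≺x (x≺xs ∷ _) (there A∈xs) =
    ≺-irrefl {A = A} (≺-trans {A = A} {x} {A} A≺x (All.lookup x≺xs A∈xs))

  take-string-LexLeq : ∀ m {P Q : List (Subset n)} → AllPairs _≺_ P → AllPairs _≺_ Q → Q ⊆ P →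
    (∀ {x y} → x ∈ P → x ∉ Q → y ∈ Q → ∣ x ∣ ≤ ∣ y ∣) → m ≤ length Q →
    LexLeq (string (take m P)) (string Q)
  take-string-LexLeq zero _ _ _ _ _ = nil
  take-string-LexLeq (suc m) {[]} {q ∷ Q} _ _ Q⊆P _ _ with () ← Q⊆P (here refl)
  take-string-LexLeq (suc m) {p ∷ P} {q ∷ Q} ↑P ↑Q Q⊆P small (s≤s m≤∣Q∣) with ≺-compare p q
  ... | tri< p≺q _ _ =
    here (≺∧∣A∣≤∣B∣⇒b< {A = p} {q} p≺q (small (here refl) (≺-head⇒∉ {A = p} p≺q ↑Q) (here refl)))
  ... | tri> _ _ q≺p = contradiction (Q⊆P (here refl)) (≺-head⇒∉ {A = q} q≺p ↑P)
  ... | tri≈ _ refl _ = there (take-string-LexLeq m (AllPairs.tail ↑P) (AllPairs.tail ↑Q)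
      (⊆-∷⁻ (Unique[x∷xs]⇒x∉xs (AllPairs⇒Unique ↑Q)) Q⊆P)
      (λ x∈P x∉Q y∈Q → small (there x∈P) (∉-∷ x∈P x∉Q) (there y∈Q))
      m≤∣Q∣)
    where
    ∉-∷ : ∀ {x} → x ∈ P → x ∉ Q → x ∉ p ∷ Q
    ∉-∷ x∈P _   (here refl) = Unique[x∷xs]⇒x∉xs (AllPairs⇒Unique ↑P) x∈P
    ∉-∷ _   x∉Q (there x∈Q) = x∉Q x∈Q

module _ {n} (π : Permutation′ n) {As : List (Subset n)} (↑As : AllPairs _≺_ As)
         (nonEmpty : ∀ X → X ∈ As → X ≢ ⊥) (m : ℕ) {Bs Cs : List (Subset n)}
         (imageB : IsImageMembers π (take m As) Bs) (imageC : IsImageMembers π As Cs) where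

  prefixImage-⊆ : Bs ⊆ Cs
  prefixImage-⊆ x∈Bs with Y , Y∈ , refl ← image-∈⁻ π imageB x∈Bs =
    image-∈⁺ π imageC nonEmpty (∈-take⇒∈ m Y∈)

  ∣outsidePrefixImage∣≤∣prefixImage∣ : ∀ {x y} → x ∈ Cs → x ∉ Bs → y ∈ Bs → ∣ x ∣ ≤ ∣ y ∣
  ∣outsidePrefixImage∣≤∣prefixImage∣ x∈Cs x∉Bs y∈Bs
    with X , X∈ , refl ← image-∈⁻ π imageC x∈Cs | Y , Y∈ , refl ← image-∈⁻ π imageB y∈Bs
    with ∈⇒∈-take⊎∈-drop m X∈
  ... | inj₁ X∈take = contradiction (image-∈⁺ π imageB (λ Z → nonEmpty Z ∘ ∈-take⇒∈ m) X∈take) x∉Bs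
  ... | inj₂ X∈drop = subst₂ _≤_ (sym (applyPerm-preserves-∣∣ π X)) (sym (applyPerm-preserves-∣∣ π Y))
                        (≺⇒∣B∣≤∣A∣ {A = Y} {X} (AllPairs-take-drop m ↑As Y∈ X∈drop))

  prefixImage-length : m ≤ length As → m ≤ length Bs
  prefixImage-length m≤∣As∣ = begin
    m                                      ≡⟨ m≤n⇒m⊓n≡m m≤∣As∣ ⟨
    m ⊓ length As                          ≡⟨ length-take m As ⟨
    length (take m As)                     ≡⟨ length-map (applyPerm π) (take m As) ⟨
    length (map (applyPerm π) (take m As)) ≤⟨ Unique-⊆⇒length-≤ uniqueImage imageInBs ⟩
    length Bs                              ∎
    where
    open ≤-Reasoning
    uniqueImage : Unique (map (applyPerm π) (take m As))
    uniqueImage =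
      UniqueProperties.map⁺ (applyPerm-injective π) (UniqueProperties.take⁺ m (AllPairs⇒Unique ↑As))
    imageInBs : map (applyPerm π) (take m As) ⊆ Bs
    imageInBs x∈ with Y , Y∈ , refl ← ∈-map⁻ (applyPerm π) x∈ =
      image-∈⁺ π imageB (λ Z → nonEmpty Z ∘ ∈-take⇒∈ m) Y∈

theorem1 : ∀ (n : ℕ) (As : List (Subset n)) →
    NonEmptyMembers As →
    UnionClosed As →
    Mem As ⊤ →
    ¬ IsTrivial As →
    Canonical As →
    ∀ (m : ℕ) → 1 ≤ m → m ≤ length As →
    Canonical (take m As)
theorem1 n As (increasing , nonEmpty) _ _ _ canonical m _ m≤∣As∣ π Bs imageB@(increasingB , _) =
  LexLeq-trans canonicalPrefix
    (take-string-LexLeq m (Increasing⇒AllPairs (proj₁ imageC)) (Increasing⇒AllPairs increasingB)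
      (prefixImage-⊆ π ↑As nonEmpty m imageB imageC)
      (∣outsidePrefixImage∣≤∣prefixImage∣ π ↑As nonEmpty m imageB imageC)
      (prefixImage-length π ↑As nonEmpty m imageB imageC m≤∣As∣))
  where
  ↑As : AllPairs _≺_ As
  ↑As = Increasing⇒AllPairs increasing
  Cs : List (Subset n)
  Cs = sortedImage π As
  imageC : IsImageMembers π As Cs
  imageC = sortedImage-isImage π (increasing , nonEmpty)
  canonicalPrefix : LexLeq (string (take m As)) (string (take m Cs))
  canonicalPrefix = subst₂ LexLeq (take-map m As) (take-map m Cs) (LexLeq-take m (canonical π Cs imageC))
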